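{- Let $m>1$ and $n\ge1$ be integers. A composition $C=(c_1,\dots,c_k)$ of $n$ belongs to $SP(n,m)$ if and only if the values $x_m(c_1),\dots,x_m(c_k)$ are pairwise distinct and the sequence $(x_m(c_1),\dots,x_m(c_k))$ is unimodal.
   Context: For a positive integer $N$, $x_m(N)$ denotes the largest power of $m$ dividing $N$ (the power itself, e.g. $x_2(50)=2$, $x_5(216)=1$). A sequence is unimodal if it is first increasing and then decreasing (either portion may be empty). Semi-$m$-Pell compositions: $SP(n,m)=\{(n)\}$ for $1\le n\le m$; if $n>m$ and $m\mid n$, $SP(n,m)$ consists of the compositions in $SP(n/m,m)$ with every part multiplied by $m$; if $n>m$ and $n\equiv r\pmod m$, $1\le r\le m-1$, $SP(n,m)$ consists of the compositions obtained by inserting a part $r$ at the beginning or end of each composition in $SP(n-r,m)$, together with those obtained from each composition in $SP(n-m,m)$ by adding $m$ to its (unique) part congruent to $r$ mod $m$. -}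

module Defs where

open import Data.Nat using (ℕ; zero; suc; _+_; _*_; _∸_; _≤_; _<_; _≥_; _>_)
open import Data.Nat.Divisibility using (_∣?_)
open import Data.Nat.DivMod using (_/_)
open import Data.List using (List; []; _∷_; _++_; [_]; map)
open import Data.List.Relation.Unary.Linked using (Linked)
open import Data.Product using (Σ; ∃; _×_)
open import Relation.Nullary using (yes; no)
open import Relation.Binary.PropositionalEquality using (_≡_)

-- x_m(N): the largest power of m dividing N (the power itself).
-- Computed by repeatedly dividing by m while m divides; the fuel N is
-- enough for m ≥ 2 and N ≥ 1 (the only cases used).
xm-go : ℕ → ℕ → ℕ → ℕ
xm-go zero    m       N = 1
xm-go (suc f) zero    N = 1
xm-go (suc f) (suc k) N with suc k ∣? N
... | yes _ = suc k * xm-go f (suc k) (N / suc k)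
... | no  _ = 1

xm : ℕ → ℕ → ℕ
xm m N = xm-go N m N

_≡_[mod_] : ℕ → ℕ → ℕ → Set
a ≡ r [mod m ] = ∃ λ q → a ≡ r + q * m

-- Semi-m-Pell compositions: SP m n C  means  C ∈ SP(n,m).
data SP (m : ℕ) : ℕ → List ℕ → Set where
  base  : ∀ {n} → 1 ≤ n → n ≤ m → SP m n [ n ]
  scale : ∀ {q C} → m * q > m → SP m q C → SP m (m * q) (map (m *_) C)
  left  : ∀ {n r C} → n > m → 1 ≤ r → r < m → n ≡ r [mod m ] →
          SP m (n ∸ r) C → SP m n (r ∷ C)
  right : ∀ {n r C} → n > m → 1 ≤ r → r < m → n ≡ r [mod m ] →
          SP m (n ∸ r) C → SP m n (C ++ [ r ])
  add   : ∀ {n r A c B} → n > m → 1 ≤ r → r < m → n ≡ r [mod m ] →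
          SP m (n ∸ m) (A ++ c ∷ B) → c ≡ r [mod m ] →
          SP m n (A ++ (c + m) ∷ B)

Unimodal : List ℕ → Set
Unimodal xs = Σ (List ℕ) λ A → Σ (List ℕ) λ B →
  xs ≡ A ++ B × Linked _≤_ A × Linked _≥_ B

module Submission where

open import Defs
open import Data.Nat
open import Data.Nat.Properties
open import Data.Nat.Divisibility
open import Data.Nat.DivMod using (m*n/n≡m; m%n<n; m≡m%n+[m/n]*n)
open import Data.Nat.Induction using (<-rec)
open import Data.Nat.ListAction using (sum)
open import Data.Nat.ListAction.Properties using (sum-++)
open import Algebra.Properties.CommutativeSemigroup +-commutativeSemigroup using (x∙yz≈y∙xz)
open import Data.List using (List; []; _∷_; _++_; [_]; map)
open import Data.List.Properties using (++-identityʳ; ++-assoc; ∷-injective; map-++; map-∘; map-cong-local)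
open import Data.List.Membership.Propositional using (find)
open import Data.List.Membership.Propositional.Properties using (∈-∃++)
open import Data.List.Relation.Unary.All as All using (All; []; _∷_; all?)
import Data.List.Relation.Unary.All.Properties as All
open import Data.List.Relation.Unary.AllPairs using (AllPairs; []; _∷_)
import Data.List.Relation.Unary.AllPairs.Properties as AllPairs
open import Data.List.Relation.Unary.Linked as Linked using (Linked; []; [-]; _∷_)
open import Data.List.Relation.Unary.Linked.Properties using (Linked⇒AllPairs)
import Data.List.Relation.Unary.Linked.Properties as Linked
open import Data.List.Relation.Unary.Unique.Propositional using (Unique)
import Data.List.Relation.Unary.Unique.Propositional.Properties as Unique
open import Data.Product using (∃-syntax; _×_; _,_; proj₁; proj₂)
open import Data.Sum using (_⊎_; inj₁; inj₂)
open import Function using (_∘_; flip)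
open import Function.Bundles using (_⇔_; mk⇔)
open import Relation.Binary.Core using (Rel)
open import Relation.Binary.PropositionalEquality
  using (_≡_; _≢_; refl; sym; trans; cong; subst; ≢-sym; module ≡-Reasoning)
open import Relation.Nullary using (¬_; Dec; yes; no; contradiction)
open import Relation.Nullary.Decidable using (decidable-stable)

-- The profile value x_m(c) is 1 exactly on the parts c with m ∤ c, exceeds 1 on the other parts,
-- and x_m(m c) = m x_m(c). Hence scaling multiplies the profile by m, adding m to the part
-- congruent to r leaves it unchanged, and inserting r < m at an end puts a strict minimum there:
-- every SP-composition has a distinct unimodal profile. Conversely, for n ≤ m distinctness leaves
-- only the one-part composition. For n > m distinctness allows at most one part c with m ∤ c, and
-- then n ≡ c (mod m). With no such part, divide every part by m. If c < m, its value 1 is a strict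
-- minimum, so unimodality puts c at an end and it is removed by the insertion rule; if c > m, it
-- arises from c - m by the adding rule.

private variable
  A : Set
  R : Rel A _
  x y : A
  xs ys : List A

++-split : ∀ (xs : List A) {ys} as {bs} → xs ++ ys ≡ as ++ bs →
  (∃[ s ] as ≡ xs ++ s × ys ≡ s ++ bs) ⊎ (∃[ t ] xs ≡ as ++ t × bs ≡ t ++ ys)
++-split []       as       eq = inj₁ (as , refl , eq)
++-split (x ∷ xs) []       eq = inj₂ (x ∷ xs , refl , sym eq)
++-split (x ∷ xs) (a ∷ as) eq with ∷-injective eq
... | refl , eq′ with ++-split xs as eq′
...   | inj₁ (s , refl , e) = inj₁ (s , refl , e)
...   | inj₂ (t , refl , e) = inj₂ (t , refl , e)

map-++⁻ : ∀ (f : A → ℕ) xs as {bs} → map f xs ≡ as ++ bs →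
  ∃[ ys ] ∃[ zs ] xs ≡ ys ++ zs × as ≡ map f ys × bs ≡ map f zs
map-++⁻ f xs       []       eq = [] , xs , refl , refl , sym eq
map-++⁻ f (x ∷ xs) (a ∷ as) eq with ∷-injective eq
... | refl , eq′ with map-++⁻ f xs as eq′
...   | ys , zs , refl , refl , refl = x ∷ ys , zs , refl , refl , refl

map-≡-[] : ∀ {B : Set} {f : A → B} xs → map f xs ≡ [] → xs ≡ []
map-≡-[] [] _ = refl

All-++-∷-replace : ∀ {P : A → Set} xs → All P (xs ++ x ∷ ys) → P y → All P (xs ++ y ∷ ys)
All-++-∷-replace xs pxs py = All.++⁺ (All.++⁻ˡ xs pxs) (py ∷ All.tail (All.++⁻ʳ xs pxs))

map-++-∷-cong : ∀ {B : Set} (f : A → B) xs → f x ≡ f y → map f (xs ++ x ∷ ys) ≡ map f (xs ++ y ∷ ys)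
map-++-∷-cong {ys = ys} f [] fx≡fy = cong (_∷ map f ys) fx≡fy
map-++-∷-cong f (x ∷ xs) fx≡fy = cong (f x ∷_) (map-++-∷-cong f xs fx≡fy)

AllPairs-++⁻ˡ : ∀ xs → AllPairs R (xs ++ ys) → AllPairs R xs
AllPairs-++⁻ˡ []       _          = []
AllPairs-++⁻ˡ (x ∷ xs) (px ∷ pxs) = All.++⁻ˡ xs px ∷ AllPairs-++⁻ˡ xs pxs

AllPairs-++⁻ʳ : ∀ xs → AllPairs R (xs ++ ys) → AllPairs R ys
AllPairs-++⁻ʳ []       pxs       = pxs
AllPairs-++⁻ʳ (x ∷ xs) (_ ∷ pxs) = AllPairs-++⁻ʳ xs pxs

AllPairs-++-∷⁻ : ∀ xs → AllPairs R (xs ++ y ∷ ys) → All (flip R y) xs × All (R y) ys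
AllPairs-++-∷⁻ []       (py ∷ _)   = [] , py
AllPairs-++-∷⁻ (x ∷ xs) (px ∷ pxs) with AllPairs-++-∷⁻ xs pxs
... | before , after = All.head (All.++⁻ʳ xs px) ∷ before , after

Linked-++⁻ˡ : ∀ xs → Linked R (xs ++ ys) → Linked R xs
Linked-++⁻ˡ []           _        = []
Linked-++⁻ˡ (x ∷ [])     _        = [-]
Linked-++⁻ˡ (x ∷ y ∷ xs) (r ∷ rs) = r ∷ Linked-++⁻ˡ (y ∷ xs) rs

Linked-++⁻ʳ : ∀ xs → Linked R (xs ++ ys) → Linked R ys
Linked-++⁻ʳ []       rs = rs
Linked-++⁻ʳ (x ∷ xs) rs = Linked-++⁻ʳ xs (Linked.tail rs)

Linked-∷⁺ : All (R x) xs → Linked R xs → Linked R (x ∷ xs)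
Linked-∷⁺ []      _  = [-]
Linked-∷⁺ (r ∷ _) rs = r ∷ rs

Linked-∷ʳ⁺ : All (flip R x) xs → Linked R xs → Linked R (xs ++ [ x ])
Linked-∷ʳ⁺ []           _        = [-]
Linked-∷ʳ⁺ (r ∷ [])     [-]      = r ∷ [-]
Linked-∷ʳ⁺ (_ ∷ r ∷ rs) (l ∷ ls) = l ∷ Linked-∷ʳ⁺ (r ∷ rs) ls

All-≤-<⇒[] : ∀ {n ns} → All (_≤ n) ns → All (n <_) ns → ns ≡ []
All-≤-<⇒[] []      []      = refl
All-≤-<⇒[] (p ∷ _) (q ∷ _) = contradiction p (<⇒≱ q)

Linked≤⇒no-greater-before : ∀ ns {n ms} → Linked _≤_ (ns ++ n ∷ ms) → All (n <_) ns → ns ≡ []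
Linked≤⇒no-greater-before ns ↑ =
  All-≤-<⇒[] (proj₁ (AllPairs-++-∷⁻ ns (Linked⇒AllPairs ≤-trans ↑)))

Linked≥⇒no-greater-after : ∀ ns {n ms} → Linked _≥_ (ns ++ n ∷ ms) → All (n <_) ms → ms ≡ []
Linked≥⇒no-greater-after ns ↓ =
  All-≤-<⇒[] (proj₂ (AllPairs-++-∷⁻ ns (Linked⇒AllPairs (flip ≤-trans) ↓)))

Unimodal-++⁻ˡ : ∀ ns {ms} → Unimodal (ns ++ ms) → Unimodal ns
Unimodal-++⁻ˡ ns (as , bs , eq , ↑as , ↓bs) with ++-split ns as eq
... | inj₁ (s , refl , _)    = ns , [] , sym (++-identityʳ ns) , Linked-++⁻ˡ ns ↑as , []
... | inj₂ (t , refl , refl) = as , t , refl , ↑as , Linked-++⁻ˡ t ↓bs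

Unimodal-++⁻ʳ : ∀ ns {ms} → Unimodal (ns ++ ms) → Unimodal ms
Unimodal-++⁻ʳ ns {ms} (as , bs , eq , ↑as , ↓bs) with ++-split ns as eq
... | inj₁ (s , refl , refl) = s , bs , refl , Linked-++⁻ʳ ns ↑as , ↓bs
... | inj₂ (t , refl , refl) = [] , ms , refl , [] , Linked-++⁻ʳ t ↓bs

Unimodal-∷⁺ : ∀ {n ns} → All (n ≤_) ns → Unimodal ns → Unimodal (n ∷ ns)
Unimodal-∷⁺ {n} n≤ (as , bs , refl , ↑as , ↓bs) =
  n ∷ as , bs , refl , Linked-∷⁺ (All.++⁻ˡ as n≤) ↑as , ↓bs

Unimodal-∷ʳ⁺ : ∀ {n ns} → All (n ≤_) ns → Unimodal ns → Unimodal (ns ++ [ n ])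
Unimodal-∷ʳ⁺ {n} n≤ (as , bs , refl , ↑as , ↓bs) =
  as , bs ++ [ n ] , ++-assoc as bs [ n ] , ↑as , Linked-∷ʳ⁺ (All.++⁻ʳ as n≤) ↓bs

Unimodal-map⁺ : ∀ {f : ℕ → ℕ} → (∀ {a b} → a ≤ b → f a ≤ f b) →
  ∀ {ns} → Unimodal ns → Unimodal (map f ns)
Unimodal-map⁺ {f} mono (as , bs , refl , ↑as , ↓bs) =
  map f as , map f bs , map-++ f as bs ,
  Linked.map⁺ (Linked.map mono ↑as) , Linked.map⁺ (Linked.map mono ↓bs)

Unimodal-map⁻ : ∀ {f : ℕ → ℕ} → (∀ {a b} → f a ≤ f b → a ≤ b) →
  ∀ ns → Unimodal (map f ns) → Unimodal ns
Unimodal-map⁻ {f} reflects ns (as , bs , eq , ↑as , ↓bs) with map-++⁻ f ns as eq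
... | ys , zs , ns≡ , refl , refl =
  ys , zs , ns≡ , Linked.map reflects (Linked.map⁻ ↑as) , Linked.map reflects (Linked.map⁻ ↓bs)

Unimodal-strict-minimum : ∀ ns {n ms} → Unimodal (ns ++ n ∷ ms) →
  All (n <_) ns → All (n <_) ms → ns ≡ [] ⊎ ms ≡ []
Unimodal-strict-minimum ns (as , bs , eq , ↑as , ↓bs) n<ns n<ms with ++-split ns as eq
... | inj₁ ([] , refl , refl)    = inj₂ (Linked≥⇒no-greater-after [] ↓bs n<ms)
... | inj₁ (_ ∷ _ , refl , refl) = inj₁ (Linked≤⇒no-greater-before ns ↑as n<ns)
... | inj₂ (t , refl , refl)     = inj₂ (Linked≥⇒no-greater-after t ↓bs n<ms)

DistinctUnimodal : List ℕ → Set
DistinctUnimodal ns = Unique ns × Unimodal ns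

DistinctUnimodal-map⁺ : ∀ {f : ℕ → ℕ} → (∀ {a b} → f a ≡ f b → a ≡ b) →
  (∀ {a b} → a ≤ b → f a ≤ f b) → ∀ {ns} → DistinctUnimodal ns → DistinctUnimodal (map f ns)
DistinctUnimodal-map⁺ inj mono (u , um) = Unique.map⁺ inj u , Unimodal-map⁺ mono um

DistinctUnimodal-map⁻ : ∀ {f : ℕ → ℕ} → (∀ {a b} → f a ≤ f b → a ≤ b) →
  ∀ ns → DistinctUnimodal (map f ns) → DistinctUnimodal ns
DistinctUnimodal-map⁻ reflects ns (u , um) = Unique.map⁻ u , Unimodal-map⁻ reflects ns um

DistinctUnimodal-∷⁺ : ∀ {n ns} → All (n <_) ns → DistinctUnimodal ns → DistinctUnimodal (n ∷ ns)
DistinctUnimodal-∷⁺ n<ns (u , um) = All.map <⇒≢ n<ns ∷ u , Unimodal-∷⁺ (All.map <⇒≤ n<ns) um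

DistinctUnimodal-∷ʳ⁺ : ∀ {n ns} → All (n <_) ns → DistinctUnimodal ns → DistinctUnimodal (ns ++ [ n ])
DistinctUnimodal-∷ʳ⁺ n<ns (u , um) =
  AllPairs.++⁺ u ([] ∷ []) (All.map (λ n<a → >⇒≢ n<a ∷ []) n<ns) ,
  Unimodal-∷ʳ⁺ (All.map <⇒≤ n<ns) um

DistinctUnimodal-∷⁻ : ∀ {n ns} → DistinctUnimodal (n ∷ ns) → DistinctUnimodal ns
DistinctUnimodal-∷⁻ {n} (u , um) = AllPairs-++⁻ʳ [ n ] u , Unimodal-++⁻ʳ [ n ] um

DistinctUnimodal-∷ʳ⁻ : ∀ {n} ns → DistinctUnimodal (ns ++ [ n ]) → DistinctUnimodal ns
DistinctUnimodal-∷ʳ⁻ ns (u , um) = AllPairs-++⁻ˡ ns u , Unimodal-++⁻ˡ ns um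

sum-++-∷ : ∀ xs x ys → sum (xs ++ x ∷ ys) ≡ x + (sum xs + sum ys)
sum-++-∷ xs x ys = trans (sum-++ xs (x ∷ ys)) (x∙yz≈y∙xz (sum xs) x (sum ys))

sum-map-* : ∀ k ns → sum (map (k *_) ns) ≡ k * sum ns
sum-map-* k []       = sym (*-zeroʳ k)
sum-map-* k (n ∷ ns) = trans (cong (k * n +_) (sum-map-* k ns)) (sym (*-distribˡ-+ k n (sum ns)))

∣-sum : ∀ {d ns} → All (d ∣_) ns → d ∣ sum ns
∣-sum []           = _ ∣0
∣-sum (d∣n ∷ d∣ns) = ∣m∣n⇒∣m+n d∣n (∣-sum d∣ns)

All-∣⇒map-* : ∀ {d ns} → All (d ∣_) ns → ∃[ qs ] ns ≡ map (d *_) qs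
All-∣⇒map-* []                       = [] , refl
All-∣⇒map-* {d} (divides q refl ∷ d∣ns) with All-∣⇒map-* d∣ns
... | qs , refl = q ∷ qs , cong (_∷ map (d *_) qs) (*-comm q d)

*-positive⁻ : ∀ {k n} → 1 ≤ k * n → 1 ≤ n
*-positive⁻ {k} {zero} 1≤k*0 = contradiction (subst (1 ≤_) (*-zeroʳ k) 1≤k*0) λ ()
*-positive⁻ {n = suc _} _    = s≤s z≤n

+≡⇒≡∸ : ∀ {a b n} → a + b ≡ n → b ≡ n ∸ a
+≡⇒≡∸ {a} {b} refl = sym (m+n∸m≡n a b)

quotient-bounds : ∀ {m N} → 1 < m → (m∣N : m ∣ N) → 1 ≤ N → 1 ≤ quotient m∣N × quotient m∣N < N
quotient-bounds (s≤s (s≤s _)) m∣N 1≤N =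
  >-nonZero⁻¹ _ ⦃ quotient≢0 m∣N ⦄ , quotient-< m∣N
  where instance _ = >-nonZero 1≤N

xm-go-pos : ∀ f m N → 1 ≤ xm-go f m N
xm-go-pos zero    m       N = ≤-refl
xm-go-pos (suc f) zero    N = ≤-refl
xm-go-pos (suc f) (suc k) N with suc k ∣? N
... | yes _ = *-mono-≤ {1} {suc k} (s≤s z≤n) (xm-go-pos f (suc k) (N / suc k))
... | no  _ = ≤-refl

xm-go-∣ : ∀ f {k N} → suc k ∣ N → xm-go (suc f) (suc k) N ≡ suc k * xm-go f (suc k) (N / suc k)
xm-go-∣ f {k} {N} k∣N with suc k ∣? N
... | yes _   = refl
... | no  k∤N = contradiction k∣N k∤N

xm-∤ : ∀ {m N} → ¬ m ∣ N → xm m N ≡ 1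
xm-∤ {m}     {zero}  _   = refl
xm-∤ {zero}  {suc N} _   = refl
xm-∤ {suc k} {suc N} m∤N with suc k ∣? suc N
... | yes m∣N = contradiction m∣N m∤N
... | no  _   = refl

xm-∤-≡ : ∀ {m a b} → ¬ m ∣ a → ¬ m ∣ b → xm m a ≡ xm m b
xm-∤-≡ m∤a m∤b = trans (xm-∤ m∤a) (sym (xm-∤ m∤b))

xm-go-fuel : ∀ {m} → 1 < m → ∀ f g N → 1 ≤ N → N ≤ f → N ≤ g → xm-go f m N ≡ xm-go g m N
xm-go-fuel _ zero    _       _ 1≤N N≤0 _ = contradiction (≤-trans 1≤N N≤0) λ ()
xm-go-fuel _ (suc f) zero    _ 1≤N _ N≤0 = contradiction (≤-trans 1≤N N≤0) λ ()
xm-go-fuel {suc (suc k)} 1<m@(s≤s (s≤s _)) (suc f) (suc g) N 1≤N N≤f N≤g with suc (suc k) ∣? N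
... | no  _   = refl
... | yes m∣N with quotient-bounds 1<m m∣N 1≤N
...   | 1≤q , q<N = cong (suc (suc k) *_)
        (subst (λ q → xm-go f _ q ≡ xm-go g _ q) (sym (n/m≡quotient m∣N))
          (xm-go-fuel 1<m f g _ 1≤q (≤-pred (≤-trans q<N N≤f)) (≤-pred (≤-trans q<N N≤g))))

xm-* : ∀ {m c} → 1 < m → 1 ≤ c → xm m (m * c) ≡ m * xm m c
xm-* {m@(suc (suc k))} {c@(suc c′)} 1<m@(s≤s (s≤s _)) _ = begin
  xm m (m * c)                 ≡⟨ xm-go-∣ F (m∣m*n c) ⟩
  m * xm-go F m (m * c / m)    ≡⟨ cong (λ q → m * xm-go F m q) (m*n/m≡n c) ⟩
  m * xm-go F m c              ≡⟨ cong (m *_) (xm-go-fuel 1<m F c c (s≤s z≤n) c≤F ≤-refl) ⟩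
  m * xm m c                   ∎
  where
  open ≡-Reasoning
  F = c′ + suc k * c
  c≤F : c ≤ F
  c≤F = ≤-trans (m≤m+n c (k * c)) (m≤n+m _ c′)
  m*n/m≡n : ∀ n → m * n / m ≡ n
  m*n/m≡n n = trans (cong (_/ m) (*-comm m n)) (m*n/n≡m n m)

module _ {m : ℕ} (1<m : 1 < m) where

  private
    1≤m : 1 ≤ m
    1≤m = <⇒≤ 1<m

    instance
      m≢0 : NonZero m
      m≢0 = >-nonZero 1≤m

  small-∤ : ∀ {r} → 1 ≤ r → r < m → ¬ m ∣ r
  small-∤ 1≤r r<m m∣r = <⇒≱ r<m (∣⇒≤ ⦃ >-nonZero 1≤r ⦄ m∣r)

  xm-∣>1 : ∀ {N} → 1 ≤ N → m ∣ N → 1 < xm m N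
  xm-∣>1 {N} 1≤N m∣N = begin-strict
    1                               <⟨ 1<m ⟩
    m                               ≡⟨ *-identityʳ m ⟨
    m * 1                           ≤⟨ *-monoʳ-≤ m (xm-go-pos q m q) ⟩
    m * xm m q                      ≡⟨ xm-* 1<m (proj₁ (quotient-bounds 1<m m∣N 1≤N)) ⟨
    xm m (m * q)                    ≡⟨ cong (xm m) (m∣n⇒n≡m*quotient m∣N) ⟨
    xm m N                          ∎
    where
    open ≤-Reasoning
    q = quotient m∣N

  xm≢1⇒∣ : ∀ {a} → xm m a ≢ 1 → m ∣ a
  xm≢1⇒∣ {a} xa≢1 = decidable-stable (m ∣? a) (xa≢1 ∘ xm-∤)

  map-xm>1 : ∀ {ns} → All (1 ≤_) ns → All (m ∣_) ns → All (1 <_) (map (xm m) ns)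
  map-xm>1 pos m∣ns = All.map⁺ (All.zipWith (λ (1≤n , m∣n) → xm-∣>1 1≤n m∣n) (pos , m∣ns))

  map-xm-* : ∀ {ns} → All (1 ≤_) ns → map (xm m) (map (m *_) ns) ≡ map (m *_) (map (xm m) ns)
  map-xm-* {ns} pos = begin
    map (xm m) (map (m *_) ns)  ≡⟨ map-∘ ns ⟨
    map (xm m ∘ (m *_)) ns      ≡⟨ map-cong-local (All.map (xm-* 1<m) pos) ⟩
    map ((m *_) ∘ xm m) ns      ≡⟨ map-∘ ns ⟩
    map (m *_) (map (xm m) ns)  ∎
    where open ≡-Reasoning

  ≡-mod-trans : ∀ {a b c} → a ≡ b [mod m ] → b ≡ c [mod m ] → a ≡ c [mod m ]
  ≡-mod-trans {c = c} (q , refl) (q′ , refl) =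
    q′ + q , trans (+-assoc c (q′ * m) (q * m)) (cong (c +_) (sym (*-distribʳ-+ m q′ q)))

  +-≡-mod : ∀ {a d} → m ∣ d → (a + d) ≡ a [mod m ]
  +-≡-mod (divides q refl) = q , refl

  ≡-mod-∤ : ∀ {n r} → 1 ≤ r → r < m → n ≡ r [mod m ] → ¬ m ∣ n
  ≡-mod-∤ {r = r} 1≤r r<m (q , refl) m∣n =
    small-∤ 1≤r r<m (∣m+n∣m⇒∣n (subst (m ∣_) (+-comm r (q * m)) m∣n) (n∣m*n q))

  ≡-mod-∸ : ∀ {n r} → n ≡ r [mod m ] → m ∣ n ∸ r
  ≡-mod-∸ {r = r} (q , refl) = divides q (m+n∸m≡n r (q * m))

  ∤⇒residue : ∀ {c} → ¬ m ∣ c → ∃[ r ] 1 ≤ r × r < m × c ≡ r [mod m ]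
  ∤⇒residue {c} m∤c =
    c % m , n≢0⇒n>0 (m∤c ∘ m%n≡0⇒n∣m c m) , m%n<n c m , c / m , m≡m%n+[m/n]*n c m

  sum-≡-mod : ∀ xs c ys → All (m ∣_) xs → All (m ∣_) ys → sum (xs ++ c ∷ ys) ≡ c [mod m ]
  sum-≡-mod xs c ys m∣xs m∣ys =
    subst (_≡ c [mod m ]) (sym (sum-++-∷ xs c ys)) (+-≡-mod (∣m∣n⇒∣m+n (∣-sum m∣xs) (∣-sum m∣ys)))

  SP⇒positive : ∀ {n C} → SP m n C → All (1 ≤_) C
  SP⇒positive (base 1≤n _)                     = 1≤n ∷ []
  SP⇒positive (scale _ sp)                     = All.map⁺ (All.map (*-mono-≤ 1≤m) (SP⇒positive sp))
  SP⇒positive (left _ 1≤r _ _ sp)              = 1≤r ∷ SP⇒positive sp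
  SP⇒positive (right _ 1≤r _ _ sp)             = All.++⁺ (SP⇒positive sp) (1≤r ∷ [])
  SP⇒positive (add {A = A} {c = c} _ _ _ _ sp _) =
    All-++-∷-replace A (SP⇒positive sp) (≤-trans 1≤m (m≤n+m m c))

  SP⇒divisible : ∀ {n C} → SP m n C → m ∣ n → All (m ∣_) C
  SP⇒divisible (base _ _)                m∣n = m∣n ∷ []
  SP⇒divisible (scale {C = C} _ _)       _   = All.map⁺ (All.universal (m∣m*n) C)
  SP⇒divisible (left _ 1≤r r<m n≡r _)    m∣n = contradiction m∣n (≡-mod-∤ 1≤r r<m n≡r)
  SP⇒divisible (right _ 1≤r r<m n≡r _)   m∣n = contradiction m∣n (≡-mod-∤ 1≤r r<m n≡r)
  SP⇒divisible (add _ 1≤r r<m n≡r _ _)   m∣n = contradiction m∣n (≡-mod-∤ 1≤r r<m n≡r)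

  SP⇒distinct-unimodal : ∀ {n C} → SP m n C → DistinctUnimodal (map (xm m) C)
  SP⇒distinct-unimodal (base _ _) = [] ∷ [] , [ _ ] , [] , refl , [-] , []
  SP⇒distinct-unimodal (scale _ sp) =
    subst DistinctUnimodal (sym (map-xm-* (SP⇒positive sp)))
      (DistinctUnimodal-map⁺ (*-cancelˡ-≡ _ _ m) (*-monoʳ-≤ m) (SP⇒distinct-unimodal sp))
  SP⇒distinct-unimodal (left _ 1≤r r<m n≡r sp) rewrite xm-∤ (small-∤ 1≤r r<m) =
    DistinctUnimodal-∷⁺ (map-xm>1 (SP⇒positive sp) (SP⇒divisible sp (≡-mod-∸ n≡r)))
      (SP⇒distinct-unimodal sp)
  SP⇒distinct-unimodal (right {r = r} {C = C} _ 1≤r r<m n≡r sp)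
    rewrite map-++ (xm m) C [ r ] | xm-∤ (small-∤ 1≤r r<m) =
    DistinctUnimodal-∷ʳ⁺ (map-xm>1 (SP⇒positive sp) (SP⇒divisible sp (≡-mod-∸ n≡r)))
      (SP⇒distinct-unimodal sp)
  SP⇒distinct-unimodal (add {A = A} _ 1≤r r<m _ sp c≡r) =
    subst DistinctUnimodal
      (map-++-∷-cong (xm m) A (xm-∤-≡ (≡-mod-∤ 1≤r r<m c≡r)
        (≡-mod-∤ 1≤r r<m (≡-mod-trans (+-≡-mod ∣-refl) c≡r))))
      (SP⇒distinct-unimodal sp)

  ∤-part-unique : ∀ xs {c} ys → ¬ m ∣ c → Unique (map (xm m) (xs ++ c ∷ ys)) →
    All (m ∣_) xs × All (m ∣_) ys
  ∤-part-unique xs {c} ys m∤c u rewrite map-++ (xm m) xs (c ∷ ys) | xm-∤ m∤c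
    with AllPairs-++-∷⁻ (map (xm m) xs) u
  ... | ≢1-before , ≢1-after =
    All.map xm≢1⇒∣ (All.map⁻ ≢1-before) , All.map (xm≢1⇒∣ ∘ ≢-sym) (All.map⁻ ≢1-after)

  ∤-part-at-end : ∀ xs {c} ys → ¬ m ∣ c → All (1 ≤_) (xs ++ c ∷ ys) →
    All (m ∣_) xs → All (m ∣_) ys → Unimodal (map (xm m) (xs ++ c ∷ ys)) → xs ≡ [] ⊎ ys ≡ []
  ∤-part-at-end xs {c} ys m∤c pos m∣xs m∣ys um
    rewrite map-++ (xm m) xs (c ∷ ys) | xm-∤ m∤c
    with Unimodal-strict-minimum (map (xm m) xs) um
           (map-xm>1 (All.++⁻ˡ xs pos) m∣xs) (map-xm>1 (All.tail (All.++⁻ʳ xs pos)) m∣ys)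
  ... | inj₁ eq = inj₁ (map-≡-[] xs eq)
  ... | inj₂ eq = inj₂ (map-≡-[] ys eq)

  SPComplete : ℕ → Set
  SPComplete n = ∀ C → 1 ≤ n → All (1 ≤_) C → sum C ≡ n → DistinctUnimodal (map (xm m) C) → SP m n C

  SP-small : ∀ {n} C → n ≤ m → 1 ≤ n → All (1 ≤_) C → sum C ≡ n → Unique (map (xm m) C) → SP m n C
  SP-small []       _   1≤n _ refl _ = contradiction 1≤n λ ()
  SP-small (c ∷ []) n≤m 1≤n _ sum≡n _ with refl ← trans (sym (+-identityʳ c)) sum≡n = base 1≤n n≤m
  SP-small (c₁ ∷ c₂ ∷ C) n≤m _ (1≤c₁ ∷ 1≤c₂ ∷ _) refl ((xc₁≢xc₂ ∷ _) ∷ _) =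
    contradiction (xm-∤-≡ (small-∤ 1≤c₁ c₁<m) (small-∤ 1≤c₂ c₂<m)) xc₁≢xc₂
    where
    c₁<m : c₁ < m
    c₁<m = <-≤-trans (m<m+n c₁ (≤-trans 1≤c₂ (m≤m+n c₂ (sum C)))) n≤m
    c₂<m : c₂ < m
    c₂<m = <-≤-trans (≤-<-trans (m≤m+n c₂ (sum C)) (m<n+m _ 1≤c₁)) n≤m

  module Step {n} (ih : ∀ {n′} → n′ < n → SPComplete n′) (m<n : m < n) where

    ih-∸ : ∀ {d} C → 1 ≤ d → d < n → All (1 ≤_) C → sum C ≡ n ∸ d →
      DistinctUnimodal (map (xm m) C) → SP m (n ∸ d) C
    ih-∸ {d} C 1≤d d<n = ih (∸-monoʳ-< {n} {d} {0} 1≤d (<⇒≤ d<n)) C (m<n⇒0<n∸m d<n)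

    divisible-case : ∀ C → All (m ∣_) C → All (1 ≤_) C → sum C ≡ n →
      DistinctUnimodal (map (xm m) C) → SP m n C
    divisible-case C m∣C pos sum≡n du with All-∣⇒map-* m∣C
    ... | qs , refl = subst (λ k → SP m k (map (m *_) qs)) m*q≡n
      (scale (subst (m <_) (sym m*q≡n) m<n) (ih q<n qs 1≤q posqs refl duqs))
      where
      m*q≡n : m * sum qs ≡ n
      m*q≡n = trans (sym (sum-map-* m qs)) sum≡n
      posqs : All (1 ≤_) qs
      posqs = All.map (*-positive⁻ {m}) (All.map⁻ pos)
      1≤q : 1 ≤ sum qs
      1≤q = *-positive⁻ {m} (subst (1 ≤_) (sym m*q≡n) (<⇒≤ (<-trans 1<m m<n)))
      q<n : sum qs < n
      q<n = subst (sum qs <_) (trans (*-comm (sum qs) m) m*q≡n) (m<m*n (sum qs) m ⦃ >-nonZero 1≤q ⦄ 1<m)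
      duqs : DistinctUnimodal (map (xm m) qs)
      duqs = DistinctUnimodal-map⁻ (*-cancelˡ-≤ m) (map (xm m) qs) (subst DistinctUnimodal (map-xm-* posqs) du)

    end-case : ∀ xs {c} ys → 1 ≤ c → c < m → n ≡ c [mod m ] → xs ≡ [] ⊎ ys ≡ [] →
      All (1 ≤_) (xs ++ c ∷ ys) → sum (xs ++ c ∷ ys) ≡ n →
      DistinctUnimodal (map (xm m) (xs ++ c ∷ ys)) → SP m n (xs ++ c ∷ ys)
    end-case .[] ys 1≤c c<m n≡c (inj₁ refl) pos sum≡n du =
      left m<n 1≤c c<m n≡c
        (ih-∸ ys 1≤c (<-trans c<m m<n) (All.tail pos) (+≡⇒≡∸ sum≡n) (DistinctUnimodal-∷⁻ du))
    end-case xs {c} .[] 1≤c c<m n≡c (inj₂ refl) pos sum≡n du =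
      right m<n 1≤c c<m n≡c
        (ih-∸ xs 1≤c (<-trans c<m m<n) (All.++⁻ˡ xs pos) sum≡n∸c
          (DistinctUnimodal-∷ʳ⁻ (map (xm m) xs) (subst DistinctUnimodal (map-++ (xm m) xs [ c ]) du)))
      where
      sum≡n∸c : sum xs ≡ n ∸ c
      sum≡n∸c = trans (sym (+-identityʳ (sum xs))) (+≡⇒≡∸ {c} (trans (sym (sum-++-∷ xs c [])) sum≡n))

    add-case : ∀ xs {c} ys → ¬ m ∣ c → m ≤ c → n ≡ c [mod m ] →
      All (1 ≤_) (xs ++ c ∷ ys) → sum (xs ++ c ∷ ys) ≡ n →
      DistinctUnimodal (map (xm m) (xs ++ c ∷ ys)) → SP m n (xs ++ c ∷ ys)
    add-case xs {c} ys m∤c m≤c n≡c pos sum≡n du =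
      let r , 1≤r , r<m , c′≡r = ∤⇒residue m∤c′ in
      subst (λ k → SP m n (xs ++ k ∷ ys)) c′+m≡c
        (add m<n 1≤r r<m (≡-mod-trans n≡c (≡-mod-trans c≡c′ c′≡r))
          (ih-∸ (xs ++ c′ ∷ ys) 1≤m m<n (All-++-∷-replace xs pos 1≤c′) sum′≡n∸m
            (subst DistinctUnimodal (map-++-∷-cong (xm m) xs (xm-∤-≡ m∤c m∤c′)) du))
          c′≡r)
      where
      open ≡-Reasoning
      c′ = c ∸ m
      c′+m≡c : c′ + m ≡ c
      c′+m≡c = m∸n+n≡m m≤c
      m∤c′ : ¬ m ∣ c′
      m∤c′ m∣c′ = m∤c (subst (m ∣_) c′+m≡c (∣m∣n⇒∣m+n m∣c′ ∣-refl))
      1≤c′ : 1 ≤ c′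
      1≤c′ = n≢0⇒n>0 (λ c′≡0 → m∤c′ (subst (m ∣_) (sym c′≡0) (m ∣0)))
      c≡c′ : c ≡ c′ [mod m ]
      c≡c′ = subst (_≡ c′ [mod m ]) c′+m≡c (+-≡-mod ∣-refl)
      sum′≡n∸m : sum (xs ++ c′ ∷ ys) ≡ n ∸ m
      sum′≡n∸m = begin
        sum (xs ++ c′ ∷ ys)          ≡⟨ sum-++-∷ xs c′ ys ⟩
        c′ + (sum xs + sum ys)       ≡⟨ +-∸-comm (sum xs + sum ys) m≤c ⟨
        c + (sum xs + sum ys) ∸ m    ≡⟨ cong (_∸ m) (trans (sym (sum-++-∷ xs c ys)) sum≡n) ⟩
        n ∸ m                        ∎

    ∤-case : ∀ xs {c} ys → ¬ m ∣ c → All (m ∣_) xs → All (m ∣_) ys →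
      All (1 ≤_) (xs ++ c ∷ ys) → sum (xs ++ c ∷ ys) ≡ n →
      DistinctUnimodal (map (xm m) (xs ++ c ∷ ys)) → SP m n (xs ++ c ∷ ys)
    ∤-case xs {c} ys m∤c m∣xs m∣ys pos sum≡n du = by-size (c <? m)
      where
      n≡c : n ≡ c [mod m ]
      n≡c = subst (_≡ c [mod m ]) sum≡n (sum-≡-mod xs c ys m∣xs m∣ys)
      by-size : Dec (c < m) → SP m n (xs ++ c ∷ ys)
      by-size (yes c<m) =
        end-case xs ys (All.head (All.++⁻ʳ xs pos)) c<m n≡c
          (∤-part-at-end xs ys m∤c pos m∣xs m∣ys (proj₂ du)) pos sum≡n du
      by-size (no c≮m) = add-case xs ys m∤c (≮⇒≥ c≮m) n≡c pos sum≡n du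

  SP-complete : ∀ n → SPComplete n
  SP-complete = <-rec SPComplete step
    where
    step : ∀ n → (∀ {n′} → n′ < n → SPComplete n′) → SPComplete n
    step n ih C 1≤n pos sum≡n du with n ≤? m
    ... | yes n≤m = SP-small C n≤m 1≤n pos sum≡n (proj₁ du)
    ... | no  n≰m with all? (m ∣?_) C
    ...   | yes m∣C = Step.divisible-case ih (≰⇒> n≰m) C m∣C pos sum≡n du
    ...   | no  m∤C with find (All.¬All⇒Any¬ (m ∣?_) C m∤C)
    ...     | c , c∈C , m∤c with ∈-∃++ c∈C
    ...       | xs , ys , refl with ∤-part-unique xs ys m∤c (proj₁ du)
    ...         | m∣xs , m∣ys = Step.∤-case ih (≰⇒> n≰m) xs ys m∤c m∣xs m∣ys pos sum≡n du

theorem3p4 : (m n : ℕ) → 1 < m → 1 ≤ n →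
    (C : List ℕ) → All (1 ≤_) C → sum C ≡ n →
    (SP m n C ⇔ (Unique (map (xm m) C) × Unimodal (map (xm m) C)))
theorem3p4 m n 1<m 1≤n C pos sum≡n =
  mk⇔ (SP⇒distinct-unimodal 1<m) (SP-complete 1<m n C 1≤n pos sum≡n)
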